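{- For each $n\ge 1$ let $D_{2n}=\langle a,b \mid a^n,\ b^2,\ abab\rangle$ be the dihedral group of order $2n$, and let $S$ be a subset of $D_{2n}$ chosen uniformly at random among all $2^{2n}$ subsets. Then \[ \mathbb{P}\big(|S+S|=|S-S|\big)\longrightarrow 1\quad\text{as } n\to\infty . \]
   Context: The group operation of $D_{2n}$ is written as juxtaposition; for $S\subseteq D_{2n}$ the sumset is $S+S=\{st : s,t\in S\}$ and the difference set is $S-S=\{st^{ -1} : s,t\in S\}$. -}

module Defs where

open import Data.Nat using (ℕ; zero; suc; _+_; _*_; _∸_; _^_; NonZero)
open import Data.Nat.DivMod using (_mod_)
open import Data.Nat.Properties using (m^n≢0)
open import Data.Fin using (Fin; toℕ) renaming (_≟_ to _≟ᶠ_)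
open import Data.Fin.Subset using (Subset)
open import Data.Bool using (Bool; true; false; _∧_; _xor_; if_then_else_)
open import Data.Bool.Properties using () renaming (_≟_ to _≟ᵇ_)
open import Data.Product using (_×_; _,_)
open import Data.List using (List; []; _∷_; map; filter; length; concatMap; allFin)
open import Data.Bool.ListAction using (any)
open import Data.Vec using (Vec; []; _∷_; lookup)
open import Data.Integer using (+_)
open import Data.Rational using (ℚ; _/_)
open import Relation.Nullary using (does)
open import Relation.Nullary.Decidable using (_×-dec_)
open import Relation.Binary.PropositionalEquality using (_≡_)

-- The dihedral group D_{2n} = ⟨ a, b | a^n, b^2, abab ⟩ (n ≥ 1).
-- The element (i , s) stands for a^i b^s  (i ∈ ℤ/n, s ∈ {0,1}, true = 1).
D₂ : ℕ → Set
D₂ n = Fin n × Bool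

negMod : (n : ℕ) .{{_ : NonZero n}} → Fin n → Fin n
negMod n i = (n ∸ toℕ i) mod n

addMod : (n : ℕ) .{{_ : NonZero n}} → Fin n → Fin n → Fin n
addMod n i j = (toℕ i + toℕ j) mod n

-- group law: a^i b^s · a^j b^t = a^(i + (-1)^s j) b^(s + t)   (since b a = a⁻¹ b)
mul : (n : ℕ) .{{_ : NonZero n}} → D₂ n → D₂ n → D₂ n
mul n (i , s) (j , t) = addMod n i (if s then negMod n j else j) , (s xor t)

inv : (n : ℕ) .{{_ : NonZero n}} → D₂ n → D₂ n
inv n (i , false) = negMod n i , false
inv n (i , true)  = i , true

eqD : {n : ℕ} → D₂ n → D₂ n → Bool
eqD (i , s) (j , t) = does ((i ≟ᶠ j) ×-dec (s ≟ᵇ t))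

elems : (n : ℕ) → List (D₂ n)
elems n = concatMap (λ i → (i , false) ∷ (i , true) ∷ []) (allFin n)

-- A subset of D_{2n} is a pair of characteristic vectors:
-- (R , F) with a^i ∈ S iff R[i] = true, and a^i b ∈ S iff F[i] = true.
SubsetD : ℕ → Set
SubsetD n = Subset n × Subset n

member : {n : ℕ} → SubsetD n → D₂ n → Bool
member (R , F) (i , false) = lookup R i
member (R , F) (i , true)  = lookup F i

imageSize : {n : ℕ} → (D₂ n → D₂ n → D₂ n) → SubsetD n → ℕ
imageSize {n} op S =
  length (filter (λ g → Data.Bool._≟_ (any (λ s → any (λ t →
            member S s ∧ member S t ∧ eqD (op s t) g) (elems n)) (elems n)) true)
         (elems n))

sumsetSize : (n : ℕ) .{{_ : NonZero n}} → SubsetD n → ℕ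
sumsetSize n = imageSize (mul n)

diffsetSize : (n : ℕ) .{{_ : NonZero n}} → SubsetD n → ℕ
diffsetSize n = imageSize (λ s t → mul n s (inv n t))

allVecs : (n : ℕ) → List (Vec Bool n)
allVecs zero    = [] ∷ []
allVecs (suc n) = concatMap (λ v → (false ∷ v) ∷ (true ∷ v) ∷ []) (allVecs n)

allSubsetsD : (n : ℕ) → List (SubsetD n)
allSubsetsD n = concatMap (λ R → map (λ F → R , F) (allVecs n)) (allVecs n)

goodCount : (n : ℕ) .{{_ : NonZero n}} → ℕ
goodCount n =
  length (filter (λ S → Data.Nat._≟_ (sumsetSize n S) (diffsetSize n S)) (allSubsetsD n))

prob : (n : ℕ) .{{_ : NonZero n}} → ℚ
prob n = _/_ (+ goodCount n) (2 ^ (2 * n)) {{m^n≢0 2 (2 * n)}}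

module Submission where

-- Every g ∈ D_{2n} is a product s t with t a reflection, and as t = t⁻¹ such a product also
-- gives g = s t⁻¹. For each g choose L pairwise disjoint pairs {s , t} with s t = g: for g = a^k
-- the pairs {a^(x + m) b , a^x b} with m ≡ ±k, for g = a^k b the pairs {a^i , a^j b} with
-- i + j ≡ k (mod n). A uniformly random S contains a fixed pair with probability 1/4,
-- independently for disjoint pairs, so S misses a whole family with probability (3/4)^L. By the
-- union bound over the 2n elements, with probability at least 1 − 2n (3/4)^L every g lies in both
-- S + S and S − S, whence |S + S| = |S − S| = 2n. Families of L ≈ √(n / 2) pairs fit into D_{2n},
-- and then 2n (3/4)^L → 0.

-- ℕ's _<_ is kept local so that it does not clash with ℚ's _<_ in the statement below.
module _ where

  open import Data.Bool using (Bool; true; false; not; _∧_; _∨_)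
  open import Data.Bool.ListAction using (any)
  open import Data.Bool.Properties
    using (∧-assoc; ∨-conicalˡ; ∨-conicalʳ; not-involutive; T-≡) renaming (_≟_ to _≟ᵇ_)
  open import Data.Fin using (Fin; toℕ; fromℕ<) renaming (_≟_ to _≟ᶠ_)
  open import Data.Fin.Properties using (toℕ-injective; toℕ-fromℕ<; toℕ<n)
  open import Data.Integer as ℤ using (_⊖_)
  import Data.Integer.Properties as ℤₚ
  open import Data.List using (List; []; _∷_; length; allFin; filter; map; concatMap) renaming (_++_ to _++ₗ_)
  open import Data.List.Membership.Propositional using (_∈_)
  open import Data.List.Membership.Propositional.Properties using (∈-allFin; ∈-concatMap⁺)
  open import Data.List.Properties using (filter-all; length-tabulate)
  open import Data.List.Relation.Unary.All using (universal)
  open import Data.List.Relation.Unary.Any as Any using (here; there)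
  open import Data.List.Relation.Unary.Any.Properties using (any⁺)
  open import Data.Nat using (ℕ; zero; suc; _+_; _*_; _∸_; _^_; _⊓_; _≤_; _<_; z≤n; s≤s; z<s; NonZero; _≤?_; _≟_)
  open import Data.Nat.DivMod using (_%_; m%n%n≡m%n; [m+n]%n≡m%n; m<n⇒m%n≡m; %-distribˡ-+)
  open import Data.Nat.Properties
  open import Data.Nat.Solver using (module +-*-Solver)
  open import Algebra.Properties.CommutativeSemigroup +-commutativeSemigroup
    using () renaming (interchange to +-interchange)
  open import Data.Product using (_×_; _,_; proj₁; proj₂; ∃)
  open import Data.Rational as ℚ using (ℚ; 1ℚ; _/_; toℚᵘ)
  import Data.Rational.Properties as ℚₚ
  open import Data.Rational.Unnormalised as ℚᵘ using (mkℚᵘ; *<*)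
  import Data.Rational.Unnormalised.Properties as ℚᵘₚ
  open import Data.Sum using (_⊎_; inj₁; inj₂)
  open import Data.Vec using (Vec; []; _∷_; _++_; take; drop; lookup)
  open import Data.Vec.Properties using (take++drop≡id)
  open import Defs
  open import Function using (_∘_; id)
  open import Function.Bundles using (Equivalence)
  open import Relation.Binary.PropositionalEquality
    using (_≡_; _≢_; refl; sym; trans; cong; cong₂; subst; subst₂; module ≡-Reasoning)
  open import Relation.Nullary using (yes; no; does; contradiction)
  open import Relation.Nullary.Decidable using (dec-true; _×-dec_)
  open import Relation.Unary using (Decidable)

  open +-*-Solver

  -- Counting Boolean vectors

  𝟙 : Bool → ℕ
  𝟙 true  = 1
  𝟙 false = 0

  sumAll : (N : ℕ) → (Vec Bool N → ℕ) → ℕ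
  sumAll zero    f = f []
  sumAll (suc N) f = sumAll N (λ v → f (false ∷ v)) + sumAll N (λ v → f (true ∷ v))

  count : (N : ℕ) → (Vec Bool N → Bool) → ℕ
  count N P = sumAll N (λ v → 𝟙 (P v))

  sumAll-cong : ∀ N {f g : Vec Bool N → ℕ} → (∀ v → f v ≡ g v) → sumAll N f ≡ sumAll N g
  sumAll-cong zero    f≗g = f≗g []
  sumAll-cong (suc N) f≗g =
    cong₂ _+_ (sumAll-cong N (λ v → f≗g (false ∷ v))) (sumAll-cong N (λ v → f≗g (true ∷ v)))

  sumAll-mono : ∀ N {f g : Vec Bool N → ℕ} → (∀ v → f v ≤ g v) → sumAll N f ≤ sumAll N g
  sumAll-mono zero    f≤g = f≤g []
  sumAll-mono (suc N) f≤g =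
    +-mono-≤ (sumAll-mono N (λ v → f≤g (false ∷ v))) (sumAll-mono N (λ v → f≤g (true ∷ v)))

  sumAll-+ : ∀ N (f g : Vec Bool N → ℕ) → sumAll N (λ v → f v + g v) ≡ sumAll N f + sumAll N g
  sumAll-+ zero    f g = refl
  sumAll-+ (suc N) f g =
    trans (cong₂ _+_ (sumAll-+ N (λ v → f (false ∷ v)) (λ v → g (false ∷ v)))
                     (sumAll-+ N (λ v → f (true ∷ v)) (λ v → g (true ∷ v))))
          (+-interchange (sumAll N (λ v → f (false ∷ v))) (sumAll N (λ v → g (false ∷ v)))
                         (sumAll N (λ v → f (true ∷ v))) (sumAll N (λ v → g (true ∷ v))))

  sumAll-const : ∀ N c → sumAll N (λ _ → c) ≡ 2 ^ N * c
  sumAll-const zero    c = sym (+-identityʳ c)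
  sumAll-const (suc N) c = begin
    sumAll N (λ _ → c) + sumAll N (λ _ → c) ≡⟨ cong₂ _+_ (sumAll-const N c) (sumAll-const N c) ⟩
    2 ^ N * c + 2 ^ N * c                   ≡⟨ solve 2 (λ x c → x :* c :+ x :* c := (con 2 :* x) :* c) refl (2 ^ N) c ⟩
    2 ^ suc N * c ∎
    where open ≡-Reasoning

  sumAll-++ : ∀ m n (f : Vec Bool (m + n) → ℕ) →
              sumAll (m + n) f ≡ sumAll m (λ u → sumAll n (λ v → f (u ++ v)))
  sumAll-++ zero    n f = refl
  sumAll-++ (suc m) n f =
    cong₂ _+_ (sumAll-++ m n (λ v → f (false ∷ v))) (sumAll-++ m n (λ v → f (true ∷ v)))

  count-split : ∀ N (P B : Vec Bool N → Bool) →
                count N P ≡ count N (λ v → P v ∧ B v) + count N (λ v → P v ∧ not (B v))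
  count-split N P B = trans (sumAll-cong N split) (sumAll-+ N _ _)
    where
    split : ∀ v → 𝟙 (P v) ≡ 𝟙 (P v ∧ B v) + 𝟙 (P v ∧ not (B v))
    split v with P v | B v
    ... | true  | true  = refl
    ... | true  | false = refl
    ... | false | _     = refl

  count-complement : ∀ N (P : Vec Bool N → Bool) → count N P + count N (λ v → not (P v)) ≡ 2 ^ N
  count-complement N P = begin
    count N P + count N (λ v → not (P v))   ≡⟨ sym (sumAll-+ N _ _) ⟩
    sumAll N (λ v → 𝟙 (P v) + 𝟙 (not (P v))) ≡⟨ sumAll-cong N one ⟩
    sumAll N (λ _ → 1)                      ≡⟨ sumAll-const N 1 ⟩
    2 ^ N * 1                               ≡⟨ *-identityʳ (2 ^ N) ⟩
    2 ^ N ∎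
    where
    open ≡-Reasoning
    one : ∀ v → 𝟙 (P v) + 𝟙 (not (P v)) ≡ 1
    one v with P v
    ... | true  = refl
    ... | false = refl

  count-mono : ∀ N {P Q : Vec Bool N → Bool} → (∀ v → P v ≡ true → Q v ≡ true) → count N P ≤ count N Q
  count-mono N {P} {Q} P⇒Q = sumAll-mono N 𝟙-mono
    where
    𝟙-mono : ∀ v → 𝟙 (P v) ≤ 𝟙 (Q v)
    𝟙-mono v with P v | P⇒Q v
    ... | false | _   = z≤n
    ... | true  | P⇒Qv rewrite P⇒Qv refl = ≤-refl

  count-∨ : ∀ N (P Q : Vec Bool N → Bool) → count N (λ v → P v ∨ Q v) ≤ count N P + count N Q
  count-∨ N P Q = ≤-trans (sumAll-mono N 𝟙-∨) (≤-reflexive (sumAll-+ N _ _))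
    where
    𝟙-∨ : ∀ v → 𝟙 (P v ∨ Q v) ≤ 𝟙 (P v) + 𝟙 (Q v)
    𝟙-∨ v with P v | Q v
    ... | true  | _ = s≤s z≤n
    ... | false | _ = ≤-refl

  count-any : ∀ N {A : Set} (f : A → Vec Bool N → Bool) (m c : ℕ) (xs : List A) →
              (∀ x → m * count N (f x) ≤ c) →
              m * count N (λ v → any (λ x → f x v) xs) ≤ length xs * c
  count-any N f m c []       _ = ≤-reflexive (begin
    m * sumAll N (λ _ → 0) ≡⟨ cong (m *_) (sumAll-const N 0) ⟩
    m * (2 ^ N * 0)        ≡⟨ solve 2 (λ m x → m :* (x :* con 0) := con 0) refl m (2 ^ N) ⟩
    0 ∎)
    where open ≡-Reasoning
  count-any N f m c (x ∷ xs) bound = begin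
    m * count N (λ v → f x v ∨ any (λ y → f y v) xs)          ≤⟨ *-monoʳ-≤ m (count-∨ N (f x) _) ⟩
    m * (count N (f x) + count N (λ v → any (λ y → f y v) xs)) ≡⟨ *-distribˡ-+ m _ _ ⟩
    m * count N (f x) + m * count N (λ v → any (λ y → f y v) xs)
      ≤⟨ +-mono-≤ (bound x) (count-any N f m c xs bound) ⟩
    c + length xs * c ∎
    where open ≤-Reasoning

  at : ∀ {N} → Vec Bool N → ℕ → Bool
  at []      _       = false
  at (b ∷ v) zero    = b
  at (b ∷ v) (suc c) = at v c

  flipAt : ∀ {N} → ℕ → Vec Bool N → Vec Bool N
  flipAt _       []      = []
  flipAt zero    (b ∷ v) = not b ∷ v
  flipAt (suc c) (b ∷ v) = b ∷ flipAt c v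

  sumAll-flipAt : ∀ N c (f : Vec Bool N → ℕ) → sumAll N (λ v → f (flipAt c v)) ≡ sumAll N f
  sumAll-flipAt zero    c       f = refl
  sumAll-flipAt (suc N) zero    f = +-comm (sumAll N (λ v → f (true ∷ v))) _
  sumAll-flipAt (suc N) (suc c) f =
    cong₂ _+_ (sumAll-flipAt N c (λ v → f (false ∷ v))) (sumAll-flipAt N c (λ v → f (true ∷ v)))

  at-flipAt : ∀ {N} {c} (v : Vec Bool N) → c < N → at (flipAt c v) c ≡ not (at v c)
  at-flipAt {c = zero}  (b ∷ v) _         = refl
  at-flipAt {c = suc c} (b ∷ v) (s≤s c<N) = at-flipAt v c<N

  at-flipAt-≢ : ∀ {N} {c d} (v : Vec Bool N) → c ≢ d → at (flipAt c v) d ≡ at v d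
  at-flipAt-≢ {c = c}     {d}     []      _   = refl
  at-flipAt-≢ {c = zero}  {zero}  (b ∷ v) c≢d = contradiction refl c≢d
  at-flipAt-≢ {c = zero}  {suc d} (b ∷ v) _   = refl
  at-flipAt-≢ {c = suc c} {zero}  (b ∷ v) _   = refl
  at-flipAt-≢ {c = suc c} {suc d} (b ∷ v) c≢d = at-flipAt-≢ v (c≢d ∘ cong suc)

  at-++ˡ : ∀ {m n} (u : Vec Bool m) (v : Vec Bool n) {c} → c < m → at (u ++ v) c ≡ at u c
  at-++ˡ (b ∷ u) v {zero}  _         = refl
  at-++ˡ (b ∷ u) v {suc c} (s≤s c<m) = at-++ˡ u v c<m

  at-++ʳ : ∀ {m n} (u : Vec Bool m) (v : Vec Bool n) c → at (u ++ v) (m + c) ≡ at v c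
  at-++ʳ []      v c = refl
  at-++ʳ (b ∷ u) v c = at-++ʳ u v c

  m+m≡2*m : ∀ m → m + m ≡ 2 * m
  m+m≡2*m m = cong (m +_) (sym (+-identityʳ m))

  -- Flipping coordinate c is a bijection exchanging the vectors with and without c.
  count-halve : ∀ N {c} (Q : Vec Bool N → Bool) → c < N → (∀ v → Q (flipAt c v) ≡ Q v) →
                count N Q ≡ 2 * count N (λ v → Q v ∧ at v c)
  count-halve N {c} Q c<N Q-inv = begin
    count N Q                                            ≡⟨ count-split N Q (λ v → at v c) ⟩
    count N with-c + count N (λ v → Q v ∧ not (at v c))  ≡⟨ cong (count N with-c +_) without≡with ⟩
    count N with-c + count N with-c                      ≡⟨ m+m≡2*m (count N with-c) ⟩
    2 * count N with-c ∎
    where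
    open ≡-Reasoning
    with-c : Vec Bool N → Bool
    with-c v = Q v ∧ at v c
    without≡with : count N (λ v → Q v ∧ not (at v c)) ≡ count N with-c
    without≡with = trans (sym (sumAll-flipAt N c _)) (sumAll-cong N flipped)
      where
      flipped : ∀ v → 𝟙 (Q (flipAt c v) ∧ not (at (flipAt c v) c)) ≡ 𝟙 (with-c v)
      flipped v rewrite Q-inv v | at-flipAt v c<N | not-involutive (at v c) = refl

  -- Disjoint pairs of coordinates

  Pair : Set
  Pair = ℕ × ℕ

  _∉ₚ_ : ℕ → Pair → Set
  c ∉ₚ (p , q) = p ≢ c × q ≢ c

  _#_ : Pair → Pair → Set
  u # (p , q) = p ∉ₚ u × q ∉ₚ u

  hits : ∀ {N} → Vec Bool N → Pair → Bool
  hits v (p , q) = at v p ∧ at v q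

  avoids : ∀ {N} → ℕ → (ℕ → Pair) → Vec Bool N → Bool
  avoids zero    P v = true
  avoids (suc L) P v = avoids L P v ∧ not (hits v (P L))

  record DisjointPairs (N L : ℕ) (P : ℕ → Pair) : Set where
    field
      inRange  : ∀ {r} → r < L → proj₁ (P r) < N × proj₂ (P r) < N
      proper   : ∀ {r} → r < L → proj₁ (P r) ≢ proj₂ (P r)
      disjoint : ∀ {r s} → r < s → s < L → P r # P s

  disjointPairs-init : ∀ {N L P} → DisjointPairs N (suc L) P → DisjointPairs N L P
  disjointPairs-init D = record
    { inRange  = λ r<L → inRange (m<n⇒m<1+n r<L)
    ; proper   = λ r<L → proper (m<n⇒m<1+n r<L)
    ; disjoint = λ r<s s<L → disjoint r<s (m<n⇒m<1+n s<L)
    }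
    where open DisjointPairs D

  disjointPairs-if-inhabited : ∀ {N L P} → (0 < L → DisjointPairs N L P) → DisjointPairs N L P
  disjointPairs-if-inhabited D = record
    { inRange  = λ r<L → DisjointPairs.inRange (D (≤-<-trans z≤n r<L)) r<L
    ; proper   = λ r<L → DisjointPairs.proper (D (≤-<-trans z≤n r<L)) r<L
    ; disjoint = λ r<s s<L → DisjointPairs.disjoint (D (≤-<-trans z≤n s<L)) r<s s<L
    }

  hits-flipAt : ∀ {N c} (v : Vec Bool N) u → c ∉ₚ u → hits (flipAt c v) u ≡ hits v u
  hits-flipAt v (p , q) (p≢c , q≢c) =
    cong₂ _∧_ (at-flipAt-≢ v (p≢c ∘ sym)) (at-flipAt-≢ v (q≢c ∘ sym))

  avoids-flipAt : ∀ {N} L P c (v : Vec Bool N) → (∀ {r} → r < L → c ∉ₚ P r) →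
                  avoids L P (flipAt c v) ≡ avoids L P v
  avoids-flipAt zero    P c v _    = refl
  avoids-flipAt (suc L) P c v free =
    cong₂ (λ a h → a ∧ not h) (avoids-flipAt L P c v (free ∘ m<n⇒m<1+n)) (hits-flipAt v (P L) (free ≤-refl))

  avoids-false : ∀ {N} L P (v : Vec Bool N) → avoids L P v ≡ false → ∃ λ r → r < L × hits v (P r) ≡ true
  avoids-false (suc L) P v avoids≡false with avoids L P v in eq | hits v (P L) in hit
  ... | true  | true  = L , ≤-refl , hit
  ... | false | _     = let r , r<L , h = avoids-false L P v eq in r , m<n⇒m<1+n r<L , h

  count-∧-hits : ∀ N (Q : Vec Bool N → Bool) {p q} → p < N → q < N → p ≢ q →
                 (∀ v → Q (flipAt p v) ≡ Q v) → (∀ v → Q (flipAt q v) ≡ Q v) →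
                 4 * count N (λ v → Q v ∧ hits v (p , q)) ≡ count N Q
  count-∧-hits N Q {p} {q} p<N q<N p≢q Q-inv-p Q-inv-q = begin
    4 * count N (λ v → Q v ∧ hits v (p , q))        ≡⟨ cong (4 *_) (sumAll-cong N (λ v → cong 𝟙 (sym (∧-assoc (Q v) _ _)))) ⟩
    4 * count N (λ v → (Q v ∧ at v p) ∧ at v q)    ≡⟨ *-assoc 2 2 (count N (λ v → (Q v ∧ at v p) ∧ at v q)) ⟩
    2 * (2 * count N (λ v → (Q v ∧ at v p) ∧ at v q)) ≡⟨ cong (2 *_) (sym (count-halve N _ q<N Qp-inv-q)) ⟩
    2 * count N (λ v → Q v ∧ at v p)              ≡⟨ sym (count-halve N Q p<N Q-inv-p) ⟩
    count N Q ∎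
    where
    open ≡-Reasoning
    Qp-inv-q : ∀ v → Q (flipAt q v) ∧ at (flipAt q v) p ≡ Q v ∧ at v p
    Qp-inv-q v = cong₂ _∧_ (Q-inv-q v) (at-flipAt-≢ v (p≢q ∘ sym))

  count-avoids : ∀ N L P → DisjointPairs N L P → 4 ^ L * count N (avoids L P) ≡ 3 ^ L * 2 ^ N
  count-avoids N zero    P _ = cong (_+ 0) (trans (sumAll-const N 1) (*-identityʳ (2 ^ N)))
  count-avoids N (suc L) P D = begin
    4 * 4 ^ L * Y       ≡⟨ solve 2 (λ a y → con 4 :* a :* y := a :* (con 4 :* y)) refl (4 ^ L) Y ⟩
    4 ^ L * (4 * Y)     ≡⟨ cong (4 ^ L *_) four-Y ⟩
    4 ^ L * (3 * cQ)    ≡⟨ solve 2 (λ a c → a :* (con 3 :* c) := con 3 :* (a :* c)) refl (4 ^ L) cQ ⟩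
    3 * (4 ^ L * cQ)    ≡⟨ cong (3 *_) (count-avoids N L P (disjointPairs-init D)) ⟩
    3 * (3 ^ L * 2 ^ N) ≡⟨ sym (*-assoc 3 (3 ^ L) (2 ^ N)) ⟩
    3 * 3 ^ L * 2 ^ N ∎
    where
    open ≡-Reasoning
    open DisjointPairs D
    Q = avoids L P
    p = proj₁ (P L)
    q = proj₂ (P L)
    cQ = count N Q
    X = count N (λ v → Q v ∧ hits v (p , q))
    Y = count N (λ v → Q v ∧ not (hits v (p , q)))
    L<1+L : L < suc L
    L<1+L = ≤-refl
    four-X : 4 * X ≡ cQ
    four-X = count-∧-hits N Q (proj₁ (inRange L<1+L)) (proj₂ (inRange L<1+L)) (proper L<1+L)
               (λ v → avoids-flipAt L P p v (λ r<L → proj₁ (disjoint r<L L<1+L)))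
               (λ v → avoids-flipAt L P q v (λ r<L → proj₂ (disjoint r<L L<1+L)))
    four-Y : 4 * Y ≡ 3 * cQ
    four-Y = +-cancelʳ-≡ cQ (4 * Y) (3 * cQ) (begin
      4 * Y + cQ      ≡⟨ cong (4 * Y +_) (sym four-X) ⟩
      4 * Y + 4 * X   ≡⟨ solve 2 (λ x y → con 4 :* y :+ con 4 :* x := con 4 :* (x :+ y)) refl X Y ⟩
      4 * (X + Y)     ≡⟨ cong (4 *_) (sym (count-split N Q (λ v → hits v (p , q)))) ⟩
      4 * cQ          ≡⟨ solve 1 (λ c → con 4 :* c := con 3 :* c :+ c) refl cQ ⟩
      3 * cQ + cQ ∎)

  -- Witnesses in the dihedral group

  lookup-fromℕ< : ∀ {n} (u : Vec Bool n) {i} (i<n : i < n) → lookup u (fromℕ< i<n) ≡ at u i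
  lookup-fromℕ< (b ∷ u) {zero}  _         = refl
  lookup-fromℕ< (b ∷ u) {suc i} (s≤s i<n) = lookup-fromℕ< u i<n

  any-≡-true : ∀ {A : Set} (f : A → Bool) {x xs} → x ∈ xs → f x ≡ true → any f xs ≡ true
  any-≡-true f x∈xs fx≡true =
    Equivalence.to T-≡ (any⁺ f (Any.map (λ { refl → Equivalence.from T-≡ fx≡true }) x∈xs))

  ∧-≡-true : ∀ {a b} → a ∧ b ≡ true → a ≡ true × b ≡ true
  ∧-≡-true {true} {true} _ = refl , refl

  any-≡-false : ∀ {A : Set} (f : A → Bool) {x xs} → x ∈ xs → any f xs ≡ false → f x ≡ false
  any-≡-false f {x} x∈xs any≡false with f x in fx
  ... | false = refl
  ... | true  = contradiction (trans (sym (any-≡-true f x∈xs fx)) any≡false) λ ()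

  ∈-elems : ∀ {n} (g : D₂ n) → g ∈ elems n
  ∈-elems (i , b) =
    ∈-concatMap⁺ (λ i → (i , false) ∷ (i , true) ∷ []) (Any.map (λ { refl → ∈-pair b }) (∈-allFin i))
    where
    ∈-pair : ∀ b → (i , b) ∈ (i , false) ∷ (i , true) ∷ []
    ∈-pair false = here refl
    ∈-pair true  = there (here refl)

  eqD-refl : ∀ {n} (g : D₂ n) → eqD g g ≡ true
  eqD-refl (i , s) = dec-true ((i ≟ᶠ i) ×-dec (s ≟ᵇ s)) (refl , refl)

  imageSize-full : ∀ {n} (_·_ : D₂ n → D₂ n → D₂ n) (S : SubsetD n) →
                   (∀ g → ∃ λ s → ∃ λ t → member S s ≡ true × member S t ≡ true × s · t ≡ g) →
                   imageSize _·_ S ≡ length (elems n)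
  imageSize-full {n} _·_ S surjective = cong length (filter-all _ (universal hit (elems n)))
    where
    hit : ∀ g → any (λ s → any (λ t → member S s ∧ member S t ∧ eqD (s · t) g) (elems n)) (elems n) ≡ true
    hit g with surjective g
    ... | s , t , s∈S , t∈S , refl = any-≡-true _ (∈-elems s) (any-≡-true _ (∈-elems t) s∧t∧eq)
      where
      s∧t∧eq : member S s ∧ member S t ∧ eqD (s · t) (s · t) ≡ true
      s∧t∧eq rewrite s∈S | t∈S = eqD-refl (s · t)

  -- Reflections are involutions, so a product s t with t a reflection also equals s t⁻¹.
  Witness : (n : ℕ) .{{_ : NonZero n}} → SubsetD n → D₂ n → Set
  Witness n S g = ∃ λ s → ∃ λ j → member S s ≡ true × member S (j , true) ≡ true × mul n s (j , true) ≡ g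

  sumsetSize≡diffsetSize : ∀ n .{{_ : NonZero n}} (S : SubsetD n) → (∀ g → Witness n S g) →
                           sumsetSize n S ≡ diffsetSize n S
  sumsetSize≡diffsetSize n S witness =
    trans (imageSize-full (mul n) S (products (λ _ _ → refl)))
          (sym (imageSize-full (λ s t → mul n s (inv n t)) S (products (λ _ _ → refl))))
    where
    products : {_·_ : D₂ n → D₂ n → D₂ n} → (∀ s j → s · (j , true) ≡ mul n s (j , true)) →
               ∀ g → ∃ λ s → ∃ λ t → member S s ≡ true × member S t ≡ true × s · t ≡ g
    products agrees g =
      let s , j , s∈S , t∈S , st≡g = witness g in s , (j , true) , s∈S , t∈S , trans (agrees s j) st≡g

  %-≡-toℕ : ∀ n .{{_ : NonZero n}} {a} (k : Fin n) → a ≡ toℕ k ⊎ a ≡ toℕ k + n → a % n ≡ toℕ k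
  %-≡-toℕ n k (inj₁ refl) = m<n⇒m%n≡m (toℕ<n k)
  %-≡-toℕ n k (inj₂ refl) = trans ([m+n]%n≡m%n (toℕ k) n) (m<n⇒m%n≡m (toℕ<n k))

  toℕ-addMod-negMod : ∀ n .{{_ : NonZero n}} (i j : Fin n) →
                      toℕ (addMod n i (negMod n j)) ≡ (toℕ i + (n ∸ toℕ j)) % n
  toℕ-addMod-negMod n i j = begin
    toℕ (addMod n i (negMod n j))  ≡⟨ toℕ-fromℕ< _ ⟩
    (toℕ i + toℕ (negMod n j)) % n ≡⟨ cong (λ x → (toℕ i + x) % n) (toℕ-fromℕ< _) ⟩
    (toℕ i + x % n) % n            ≡⟨ %-distribˡ-+ (toℕ i) (x % n) n ⟩
    (toℕ i % n + x % n % n) % n    ≡⟨ cong (λ y → (toℕ i % n + y) % n) (m%n%n≡m%n x n) ⟩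
    (toℕ i % n + x % n) % n        ≡⟨ sym (%-distribˡ-+ (toℕ i) x n) ⟩
    (toℕ i + x) % n ∎
    where
    open ≡-Reasoning
    x = n ∸ toℕ j

  witness-reflection : ∀ n .{{_ : NonZero n}} (R F : Vec Bool n) (k : Fin n) {i j} (i<n : i < n) (j<n : j < n) →
                       (i + j) % n ≡ toℕ k → at R i ≡ true → at F j ≡ true → Witness n (R , F) (k , true)
  witness-reflection n R F k {i} {j} i<n j<n i+j≡k Ri Fj =
    (fromℕ< i<n , false) , fromℕ< j<n ,
    trans (lookup-fromℕ< R i<n) Ri , trans (lookup-fromℕ< F j<n) Fj ,
    cong (_, true) (toℕ-injective (begin
      toℕ (addMod n (fromℕ< i<n) (fromℕ< j<n))          ≡⟨ toℕ-fromℕ< _ ⟩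
      (toℕ (fromℕ< i<n) + toℕ (fromℕ< j<n)) % n
        ≡⟨ cong₂ (λ a b → (a + b) % n) (toℕ-fromℕ< i<n) (toℕ-fromℕ< j<n) ⟩
      (i + j) % n                                       ≡⟨ i+j≡k ⟩
      toℕ k ∎))
    where open ≡-Reasoning

  witness-rotation : ∀ n .{{_ : NonZero n}} (R F : Vec Bool n) (k : Fin n) {x y} (x<n : x < n) (y<n : y < n) →
                     (x + (n ∸ y)) % n ≡ toℕ k → at F x ≡ true → at F y ≡ true → Witness n (R , F) (k , false)
  witness-rotation n R F k {x} {y} x<n y<n x-y≡k Fx Fy =
    (fromℕ< x<n , true) , fromℕ< y<n ,
    trans (lookup-fromℕ< F x<n) Fx , trans (lookup-fromℕ< F y<n) Fy ,
    cong (_, false) (toℕ-injective (begin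
      toℕ (addMod n (fromℕ< x<n) (negMod n (fromℕ< y<n))) ≡⟨ toℕ-addMod-negMod n (fromℕ< x<n) (fromℕ< y<n) ⟩
      (toℕ (fromℕ< x<n) + (n ∸ toℕ (fromℕ< y<n))) % n
        ≡⟨ cong₂ (λ a b → (a + (n ∸ b)) % n) (toℕ-fromℕ< x<n) (toℕ-fromℕ< y<n) ⟩
      (x + (n ∸ y)) % n                                  ≡⟨ x-y≡k ⟩
      toℕ k ∎))
    where open ≡-Reasoning

  -- The pair families for rotations and reflections

  crossPairs-disjoint : ∀ n L (I J : ℕ → ℕ) → (∀ {r} → r < L → I r < n × J r < n) →
                        (∀ {r s} → r < s → s < L → I r ≢ I s × J r ≢ J s) →
                        DisjointPairs (n + n) L (λ r → I r , n + J r)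
  crossPairs-disjoint n L I J bounded injective = record
    { inRange  = λ r<L → <-≤-trans (left r<L) (m≤m+n n n) , +-monoʳ-< n (proj₂ (bounded r<L))
    ; proper   = λ r<L → left≢right (left r<L)
    ; disjoint = λ r<s s<L → let Ir≢Is , Jr≢Js = injective r<s s<L in
        (Ir≢Is , left≢right (left s<L) ∘ sym) ,
        (left≢right (left (<-trans r<s s<L)) , Jr≢Js ∘ +-cancelˡ-≡ n _ _)
    }
    where
    left : ∀ {r} → r < L → I r < n
    left = proj₁ ∘ bounded
    left≢right : ∀ {i j} → i < n → i ≢ n + j
    left≢right {j = j} i<n = <⇒≢ (<-≤-trans i<n (m≤m+n n j))

  gapPairs-disjoint : ∀ N L m (X : ℕ → ℕ) → 1 ≤ m → (∀ {r} → r < L → X r + m < N) →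
                      (∀ {r s} → r < s → s < L → X r < X s × X r + m ≢ X s) →
                      DisjointPairs N L (λ r → X r , X r + m)
  gapPairs-disjoint N L m X 1≤m bounded increasing = record
    { inRange  = λ r<L → ≤-<-trans (m≤m+n _ m) (bounded r<L) , bounded r<L
    ; proper   = λ _ → <⇒≢ (m<m+n _ 1≤m)
    ; disjoint = λ r<s s<L → let Xr<Xs , Xr+m≢Xs = increasing r<s s<L in
        (<⇒≢ Xr<Xs , Xr+m≢Xs) ,
        (<⇒≢ (<-≤-trans Xr<Xs (m≤m+n _ m)) , <⇒≢ (+-monoˡ-< m Xr<Xs))
    }

  -- L pairs (i , j) with i + j ≡ k (mod n): i + j = k if there is room (L ≤ k + 1), else i + j = k + n.
  reflectionPair : (n L k : ℕ) → ℕ → ℕ × ℕ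
  reflectionPair n L k r with L ≤? suc k
  ... | yes _ = r , k ∸ r
  ... | no  _ = suc k + r , n ∸ suc r

  module _ {n L k : ℕ} (L+L≤n : L + L ≤ n) (k<n : k < n) where

    private
      I J : ℕ → ℕ
      I = proj₁ ∘ reflectionPair n L k
      J = proj₂ ∘ reflectionPair n L k

    reflectionPair-sum : ∀ {r} → r < L → I r < n × J r < n × (I r + J r ≡ k ⊎ I r + J r ≡ k + n)
    reflectionPair-sum {r} r<L with L ≤? suc k
    ... | yes L≤1+k = ≤-<-trans r≤k k<n , ≤-<-trans (m∸n≤m k r) k<n , inj₁ (m+[n∸m]≡n r≤k)
      where
      r≤k : r ≤ k
      r≤k = ≤-pred (<-≤-trans r<L L≤1+k)
    ... | no  L≰1+k = <-≤-trans (+-mono-< (≰⇒> L≰1+k) r<L) L+L≤n , ∸-monoʳ-< z<s 1+r≤n , inj₂ wraps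
      where
      1+r≤n : suc r ≤ n
      1+r≤n = ≤-trans r<L (≤-trans (m≤m+n L L) L+L≤n)
      wraps : suc k + r + (n ∸ suc r) ≡ k + n
      wraps = begin
        suc k + r + (n ∸ suc r)   ≡⟨ cong (_+ (n ∸ suc r)) (sym (+-suc k r)) ⟩
        k + suc r + (n ∸ suc r)   ≡⟨ +-assoc k (suc r) _ ⟩
        k + (suc r + (n ∸ suc r)) ≡⟨ cong (k +_) (m+[n∸m]≡n 1+r≤n) ⟩
        k + n ∎
        where open ≡-Reasoning

    reflectionPair-injective : ∀ {r s} → r < s → s < L → I r ≢ I s × J r ≢ J s
    reflectionPair-injective {r} {s} r<s s<L with L ≤? suc k
    ... | yes L≤1+k = <⇒≢ r<s , >⇒≢ (∸-monoʳ-< r<s (≤-pred (<-≤-trans s<L L≤1+k)))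
    ... | no  _     = <⇒≢ r<s ∘ +-cancelˡ-≡ (suc k) r s ,
                      >⇒≢ (∸-monoʳ-< (s≤s r<s) (≤-trans s<L (≤-trans (m≤m+n L L) L+L≤n)))

    reflectionPairs-disjoint : DisjointPairs (n + n) L (λ r → I r , n + J r)
    reflectionPairs-disjoint = crossPairs-disjoint n L I J
      (λ r<L → let i<n , j<n , _ = reflectionPair-sum r<L in i<n , j<n) reflectionPair-injective

  L+L≤2*L*L : ∀ L → L + L ≤ 2 * L * L
  L+L≤2*L*L zero    = z≤n
  L+L≤2*L*L (suc L) = subst (_≤ 2 * suc L * suc L) (sym (m+m≡2*m (suc L))) (m≤m*n (2 * suc L) (suc L))

  -- The gap m of the pairs (x , x + m) used for the rotation a^k: m ≡ ±k (mod n) and 2 m ≤ n.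
  -- For k = 0 a single element of S suffices, and m = 1 merely keeps the pairs proper.
  gap : ℕ → ℕ → ℕ
  gap n zero      = 1
  gap n k@(suc _) = k ⊓ (n ∸ k)

  gap-bounds : ∀ {n k} → k < n → 2 ≤ n → 1 ≤ gap n k × 2 * gap n k ≤ n
  gap-bounds {n} {zero}  _   2≤n = s≤s z≤n , 2≤n
  gap-bounds {n} {suc k} k<n _   = ⊓-glb (s≤s z≤n) (m<n⇒0<n∸m k<n) , (begin
    2 * m                    ≡⟨ m+m≡2*m m ⟨
    m + m                    ≤⟨ +-mono-≤ (m⊓n≤m (suc k) _) (m⊓n≤n (suc k) _) ⟩
    suc k + (n ∸ suc k)      ≡⟨ m+[n∸m]≡n (<⇒≤ k<n) ⟩
    n ∎)
    where
    open ≤-Reasoning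
    m = suc k ⊓ (n ∸ suc k)

  -- Consecutive starts r when the pairs (r , r + m) are already disjoint, otherwise spaced by 2 m.
  rotationStart : (L m : ℕ) → ℕ → ℕ
  rotationStart L m r with L ≤? m
  ... | yes _ = r
  ... | no  _ = 2 * m * r

  module _ {n L m : ℕ} (2LL≤n : 2 * L * L ≤ n) (1≤m : 1 ≤ m) (2m≤n : 2 * m ≤ n) where

    private
      X : ℕ → ℕ
      X = rotationStart L m

    rotationStart-bound : ∀ {r} → r < L → X r + m < n
    rotationStart-bound {r} r<L with L ≤? m
    ... | yes L≤m = <-≤-trans (+-monoˡ-< m (<-≤-trans r<L L≤m)) (subst (_≤ n) (sym (m+m≡2*m m)) 2m≤n)
    ... | no  L≰m = begin-strict
      2 * m * r + m         <⟨ +-monoʳ-< (2 * m * r) (subst (m <_) (m+m≡2*m m) (m<m+n m 1≤m)) ⟩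
      2 * m * r + 2 * m     ≡⟨ trans (+-comm (2 * m * r) (2 * m)) (sym (*-suc (2 * m) r)) ⟩
      2 * m * suc r         ≤⟨ *-monoʳ-≤ (2 * m) r<L ⟩
      2 * m * L             ≤⟨ *-monoˡ-≤ L (*-monoʳ-≤ 2 (<⇒≤ (≰⇒> L≰m))) ⟩
      2 * L * L             ≤⟨ 2LL≤n ⟩
      n ∎
      where open ≤-Reasoning

    rotationStart-increasing : ∀ {r s} → r < s → s < L → X r < X s × X r + m ≢ X s
    rotationStart-increasing {r} {s} r<s s<L with L ≤? m
    ... | yes L≤m = r<s , >⇒≢ (<-≤-trans s<L (≤-trans L≤m (m≤n+m m r)))
    ... | no  _   = ≤-<-trans (m≤m+n (2 * m * r) m) next , <⇒≢ next
      where
      next : 2 * m * r + m < 2 * m * s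
      next = begin-strict
        2 * m * r + m     <⟨ +-monoʳ-< (2 * m * r) (subst (m <_) (m+m≡2*m m) (m<m+n m 1≤m)) ⟩
        2 * m * r + 2 * m ≡⟨ trans (+-comm (2 * m * r) (2 * m)) (sym (*-suc (2 * m) r)) ⟩
        2 * m * suc r     ≤⟨ *-monoʳ-≤ (2 * m) r<s ⟩
        2 * m * s ∎
        where open ≤-Reasoning

    rotationPairs-disjoint : DisjointPairs (n + n) L (λ r → n + X r , n + X r + m)
    rotationPairs-disjoint = gapPairs-disjoint (n + n) L m (λ r → n + X r) 1≤m
      (λ r<L → subst (_< n + n) (sym (+-assoc n _ m)) (+-monoʳ-< n (rotationStart-bound r<L)))
      (λ r<s s<L → let Xr<Xs , Xr+m≢Xs = rotationStart-increasing r<s s<L in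
         +-monoʳ-< n Xr<Xs , Xr+m≢Xs ∘ +-cancelˡ-≡ n _ _ ∘ trans (sym (+-assoc n _ m)))

  m+n+[o∸m]≡n+o : ∀ {m o} n → m ≤ o → m + n + (o ∸ m) ≡ n + o
  m+n+[o∸m]≡n+o {m} {o} n m≤o = begin
    m + n + (o ∸ m)   ≡⟨ cong (_+ (o ∸ m)) (+-comm m n) ⟩
    n + m + (o ∸ m)   ≡⟨ +-assoc n m (o ∸ m) ⟩
    n + (m + (o ∸ m)) ≡⟨ cong (n +_) (m+[n∸m]≡n m≤o) ⟩
    n + o ∎
    where open ≡-Reasoning

  m+[o∸[m+n]]≡o∸n : ∀ m {n o} → m + n ≤ o → m + (o ∸ (m + n)) ≡ o ∸ n
  m+[o∸[m+n]]≡o∸n m {n} {o} m+n≤o = trans (sym (+-∸-assoc m m+n≤o)) ([m+n]∸[m+o]≡n∸o m o n)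

  rotationWitness : ∀ n .{{_ : NonZero n}} (R F : Vec Bool n) (k : Fin n) {x} → x + gap n (toℕ k) < n →
                    at F x ≡ true → at F (x + gap n (toℕ k)) ≡ true → Witness n (R , F) (k , false)
  rotationWitness n R F k {x} bound Fx Fx+m with toℕ k in k≡ | toℕ<n k
  ... | zero | _ =
    witness-rotation n R F k x<n x<n (%-≡-toℕ n k (inj₂ (trans (m+[n∸m]≡n (<⇒≤ x<n)) (cong (_+ n) (sym k≡))))) Fx Fx
    where
    x<n : x < n
    x<n = ≤-<-trans (m≤m+n x 1) bound
  ... | suc k′ | k<n with ⊓-sel (suc k′) (n ∸ suc k′)
  ...   | inj₁ m≡k rewrite m≡k =
    witness-rotation n R F k bound x<n
      (%-≡-toℕ n k (inj₂ (trans (m+n+[o∸m]≡n+o (suc k′) (<⇒≤ x<n)) (cong (_+ n) (sym k≡))))) Fx+m Fx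
    where
    x<n : x < n
    x<n = ≤-<-trans (m≤m+n x (suc k′)) bound
  ...   | inj₂ m≡n-k rewrite m≡n-k =
    witness-rotation n R F k (≤-<-trans (m≤m+n x _) bound) bound
      (%-≡-toℕ n k (inj₁ (trans (m+[o∸[m+n]]≡o∸n x (<⇒≤ bound)) (trans (m∸[m∸n]≡n (<⇒≤ k<n)) (sym k≡)))))
      Fx Fx+m

  -- Coordinate i < n of R ++ F records a^i ∈ S, coordinate n + j records a^j b ∈ S.
  rotationPairs : (n L k : ℕ) → ℕ → Pair
  rotationPairs n L k r = n + rotationStart L (gap n k) r , n + rotationStart L (gap n k) r + gap n k

  reflectionPairs : (n L k : ℕ) → ℕ → Pair
  reflectionPairs n L k r = proj₁ (reflectionPair n L k r) , n + proj₂ (reflectionPair n L k r)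

  unluckyAt : (n L k : ℕ) → Vec Bool (n + n) → Bool
  unluckyAt n L k w = avoids L (rotationPairs n L k) w ∨ avoids L (reflectionPairs n L k) w

  unlucky : (n L : ℕ) → Vec Bool (n + n) → Bool
  unlucky n L w = any (λ k → unluckyAt n L (toℕ k) w) (allFin n)

  module _ (n : ℕ) .{{_ : NonZero n}} {L : ℕ} (2LL≤n : 2 * L * L ≤ n) where

    private
      L+L≤n : L + L ≤ n
      L+L≤n = ≤-trans (L+L≤2*L*L L) 2LL≤n

      gap-bounds′ : (k : Fin n) → 0 < L → 1 ≤ gap n (toℕ k) × 2 * gap n (toℕ k) ≤ n
      gap-bounds′ k 0<L = gap-bounds (toℕ<n k) (≤-trans (+-mono-≤ 0<L 0<L) L+L≤n)

    lucky⇒witnesses : ∀ R F → unlucky n L (R ++ F) ≡ false → ∀ g → Witness n (R , F) g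
    lucky⇒witnesses R F lucky (k , b) = witness b (any-≡-false _ (∈-allFin k) lucky)
      where
      witness : ∀ b → unluckyAt n L (toℕ k) (R ++ F) ≡ false → Witness n (R , F) (k , b)
      witness false lucky-k
        with avoids-false L (rotationPairs n L (toℕ k)) (R ++ F) (∨-conicalˡ _ _ lucky-k)
      ... | r , r<L , hit with ∧-≡-true hit | gap-bounds′ k (≤-<-trans z≤n r<L)
      ... | hit₁ , hit₂ | 1≤m , 2m≤n =
        rotationWitness n R F k (rotationStart-bound 2LL≤n 1≤m 2m≤n r<L)
          (trans (sym (at-++ʳ R F _)) hit₁)
          (trans (sym (at-++ʳ R F _)) (trans (cong (at (R ++ F)) (sym (+-assoc n _ _))) hit₂))
      witness true lucky-k
        with avoids-false L (reflectionPairs n L (toℕ k)) (R ++ F) (∨-conicalʳ _ _ lucky-k)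
      ... | r , r<L , hit with ∧-≡-true hit | reflectionPair-sum L+L≤n (toℕ<n k) r<L
      ... | hit₁ , hit₂ | i<n , j<n , i+j≡k =
        witness-reflection n R F k i<n j<n (%-≡-toℕ n k i+j≡k)
          (trans (sym (at-++ˡ R F i<n)) hit₁) (trans (sym (at-++ʳ R F _)) hit₂)

    count-unlucky : 4 ^ L * count (n + n) (unlucky n L) ≤ n * (2 * (3 ^ L * 2 ^ (n + n)))
    count-unlucky = subst (λ l → 4 ^ L * count (n + n) (unlucky n L) ≤ l * (2 * C)) (length-tabulate {n = n} id)
      (count-any (n + n) _ (4 ^ L) (2 * C) (allFin n) bound)
      where
      C = 3 ^ L * 2 ^ (n + n)
      bound : ∀ k → 4 ^ L * count (n + n) (unluckyAt n L (toℕ k)) ≤ 2 * C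
      bound k = begin
        4 ^ L * count (n + n) (λ w → rotation w ∨ reflection w)
          ≤⟨ *-monoʳ-≤ (4 ^ L) (count-∨ (n + n) rotation reflection) ⟩
        4 ^ L * (count (n + n) rotation + count (n + n) reflection)       ≡⟨ *-distribˡ-+ (4 ^ L) _ _ ⟩
        4 ^ L * count (n + n) rotation + 4 ^ L * count (n + n) reflection ≡⟨ cong₂ _+_ rotation-count reflection-count ⟩
        C + C                                                             ≡⟨ m+m≡2*m C ⟩
        2 * C ∎
        where
        open ≤-Reasoning
        rotation reflection : Vec Bool (n + n) → Bool
        rotation   = avoids L (rotationPairs n L (toℕ k))
        reflection = avoids L (reflectionPairs n L (toℕ k))
        rotation-count : 4 ^ L * count (n + n) rotation ≡ C
        rotation-count = count-avoids (n + n) L _ (disjointPairs-if-inhabited (λ 0<L →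
          let 1≤m , 2m≤n = gap-bounds′ k 0<L in rotationPairs-disjoint 2LL≤n 1≤m 2m≤n))
        reflection-count : 4 ^ L * count (n + n) reflection ≡ C
        reflection-count = count-avoids (n + n) L _ (reflectionPairs-disjoint L+L≤n (toℕ<n k))

  -- Enumerating the subsets of D_{2n}

  sumList : ∀ {A : Set} → (A → ℕ) → List A → ℕ
  sumList f []       = 0
  sumList f (x ∷ xs) = f x + sumList f xs

  length-filter≡sumList : ∀ {A : Set} {P : A → Set} (P? : Decidable P) xs →
                  length (filter P? xs) ≡ sumList (λ x → 𝟙 (does (P? x))) xs
  length-filter≡sumList P? []       = refl
  length-filter≡sumList P? (x ∷ xs) with does (P? x)
  ... | true  = cong suc (length-filter≡sumList P? xs)
  ... | false = length-filter≡sumList P? xs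

  sumList-++ : ∀ {A : Set} (f : A → ℕ) xs ys → sumList f (xs ++ₗ ys) ≡ sumList f xs + sumList f ys
  sumList-++ f []       ys = refl
  sumList-++ f (x ∷ xs) ys = trans (cong (f x +_) (sumList-++ f xs ys)) (sym (+-assoc (f x) _ _))

  sumList-concatMap : ∀ {A B : Set} (f : B → ℕ) (g : A → List B) xs →
                      sumList f (concatMap g xs) ≡ sumList (λ x → sumList f (g x)) xs
  sumList-concatMap f g []       = refl
  sumList-concatMap f g (x ∷ xs) = trans (sumList-++ f (g x) _) (cong (sumList f (g x) +_) (sumList-concatMap f g xs))

  sumList-map : ∀ {A B : Set} (f : B → ℕ) (h : A → B) xs → sumList f (map h xs) ≡ sumList (f ∘ h) xs
  sumList-map f h []       = refl
  sumList-map f h (x ∷ xs) = cong (f (h x) +_) (sumList-map f h xs)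

  sumList-allVecs : ∀ N (f : Vec Bool N → ℕ) → sumList f (allVecs N) ≡ sumAll N f
  sumList-allVecs zero    f = +-identityʳ (f [])
  sumList-allVecs (suc N) f = begin
    sumList f (allVecs (suc N))                                      ≡⟨ sumList-concatMap f _ (allVecs N) ⟩
    sumList (λ v → f (false ∷ v) + (f (true ∷ v) + 0)) (allVecs N)  ≡⟨ sumList-allVecs N _ ⟩
    sumAll N (λ v → f (false ∷ v) + (f (true ∷ v) + 0))
      ≡⟨ sumAll-cong N (λ v → cong (f (false ∷ v) +_) (+-identityʳ _)) ⟩
    sumAll N (λ v → f (false ∷ v) + f (true ∷ v))                   ≡⟨ sumAll-+ N _ _ ⟩
    sumAll (suc N) f ∎
    where open ≡-Reasoning

  halves : (n : ℕ) → Vec Bool (n + n) → SubsetD n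
  halves n w = take n w , drop n w

  halves-++ : ∀ {n} (R F : Vec Bool n) → halves n (R ++ F) ≡ (R , F)
  halves-++ {n} R F = cong₂ _,_ (take-++ R F) (drop-++ R F)
    where
    take-++ : ∀ {m} (u : Vec Bool m) (v : Vec Bool n) → take m (u ++ v) ≡ u
    take-++ []      v = refl
    take-++ (b ∷ u) v = cong (b ∷_) (take-++ u v)
    drop-++ : ∀ {m} (u : Vec Bool m) (v : Vec Bool n) → drop m (u ++ v) ≡ v
    drop-++ []      v = refl
    drop-++ (b ∷ u) v = drop-++ u v

  sumList-allSubsetsD : ∀ n (h : SubsetD n → ℕ) → sumList h (allSubsetsD n) ≡ sumAll (n + n) (h ∘ halves n)
  sumList-allSubsetsD n h = begin
    sumList h (allSubsetsD n)                                   ≡⟨ sumList-concatMap h _ (allVecs n) ⟩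
    sumList (λ R → sumList h (map (R ,_) (allVecs n))) (allVecs n)
      ≡⟨ sumList-cong (allVecs n) (λ R → trans (sumList-map h (R ,_) (allVecs n)) (sumList-allVecs n _)) ⟩
    sumList (λ R → sumAll n (λ F → h (R , F))) (allVecs n)       ≡⟨ sumList-allVecs n _ ⟩
    sumAll n (λ R → sumAll n (λ F → h (R , F)))
      ≡⟨ sumAll-cong n (λ R → sumAll-cong n (λ F → cong h (sym (halves-++ R F)))) ⟩
    sumAll n (λ R → sumAll n (λ F → h (halves n (R ++ F))))     ≡⟨ sym (sumAll-++ n n _) ⟩
    sumAll (n + n) (h ∘ halves n) ∎
    where
    open ≡-Reasoning
    sumList-cong : ∀ {A : Set} {f g : A → ℕ} xs → (∀ x → f x ≡ g x) → sumList f xs ≡ sumList g xs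
    sumList-cong []       f≗g = refl
    sumList-cong (x ∷ xs) f≗g = cong₂ _+_ (f≗g x) (sumList-cong xs f≗g)

  -- Asymptotics

  m≤c*m*m : ∀ c .{{_ : NonZero c}} m → m ≤ c * m * m
  m≤c*m*m c zero    = z≤n
  m≤c*m*m c (suc m) = ≤-trans (m≤m*n (suc m) (suc m)) (*-monoˡ-≤ (suc m) (m≤n*m (suc m) c))

  rootBelow : (c n b : ℕ) → ℕ
  rootBelow c n zero    = 0
  rootBelow c n (suc b) with c * suc b * suc b ≤? n
  ... | yes _ = suc b
  ... | no  _ = rootBelow c n b

  rootBelow-sound : ∀ c n b → c * rootBelow c n b * rootBelow c n b ≤ n
  rootBelow-sound c n zero    rewrite *-zeroʳ c = z≤n
  rootBelow-sound c n (suc b) with c * suc b * suc b ≤? n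
  ... | yes ct²≤n = ct²≤n
  ... | no  _     = rootBelow-sound c n b

  rootBelow-maximal : ∀ c n b {t} → t ≤ b → c * t * t ≤ n → t ≤ rootBelow c n b
  rootBelow-maximal c n zero    z≤n _ = z≤n
  rootBelow-maximal c n (suc b) {t} t≤1+b ct²≤n with c * suc b * suc b ≤? n | m≤n⇒m<n∨m≡n t≤1+b
  ... | yes _   | _         = t≤1+b
  ... | no  _   | inj₁ t<1+b = rootBelow-maximal c n b (≤-pred t<1+b) ct²≤n
  ... | no  c≰n | inj₂ refl  = contradiction ct²≤n c≰n

  root : (c n : ℕ) → ℕ
  root c n = rootBelow c n n

  root-sound : ∀ c n → c * root c n * root c n ≤ n
  root-sound c n = rootBelow-sound c n n

  root-maximal : ∀ c .{{_ : NonZero c}} {n t} → c * t * t ≤ n → t ≤ root c n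
  root-maximal c {n} ct²≤n = rootBelow-maximal c n n (≤-trans (m≤c*m*m c _) ct²≤n) ct²≤n

  root-upper : ∀ c .{{_ : NonZero c}} n → n < c * suc (root c n) * suc (root c n)
  root-upper c n with c * suc (root c n) * suc (root c n) ≤? n
  ... | yes too-small = contradiction (root-maximal c too-small) (n≮n (root c n))
  ... | no  n<        = ≰⇒> n<

  ^-distribʳ-* : ∀ a b t → (a * b) ^ t ≡ a ^ t * b ^ t
  ^-distribʳ-* a b zero    = refl
  ^-distribʳ-* a b (suc t) = begin
    a * b * (a * b) ^ t     ≡⟨ cong (a * b *_) (^-distribʳ-* a b t) ⟩
    a * b * (a ^ t * b ^ t) ≡⟨ solve 4 (λ a b x y → a :* b :* (x :* y) := (a :* x) :* (b :* y)) refl a b (a ^ t) (b ^ t) ⟩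
    a * a ^ t * (b * b ^ t) ∎
    where open ≡-Reasoning

  [1+t]²≤4^t : ∀ t → suc t * suc t ≤ 4 ^ t
  [1+t]²≤4^t zero    = ≤-refl
  [1+t]²≤4^t (suc t) = begin
    suc (suc t) * suc (suc t)                        ≤⟨ m≤m+n _ (3 * t * t + 4 * t) ⟩
    suc (suc t) * suc (suc t) + (3 * t * t + 4 * t)  ≡⟨ solve 1 (λ t → (con 2 :+ t) :* (con 2 :+ t) :+ (con 3 :* t :* t :+ con 4 :* t)
                                                                       := con 4 :* ((con 1 :+ t) :* (con 1 :+ t))) refl t ⟩
    4 * (suc t * suc t)                              ≤⟨ *-monoʳ-≤ 4 ([1+t]²≤4^t t) ⟩
    4 * 4 ^ t ∎
    where open ≤-Reasoning

  -- 16 · 3¹⁰ < 4¹⁰, so (4/3)^(10 t) exceeds 16^t ≥ (1 + t)⁴.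
  2nd3^[10t]<4^[10t] : ∀ n d .{{_ : NonZero d}} t → n < 200 * suc t * suc t → 400 * d ≤ suc t →
                       2 * n * d * 3 ^ (10 * t) < 4 ^ (10 * t)
  2nd3^[10t]<4^[10t] n d t n<200[1+t]² 400d≤1+t = begin-strict
    2 * n * d * 3 ^ (10 * t)          <⟨ *-monoˡ-< (3 ^ (10 * t)) {{m^n≢0 3 (10 * t)}} 2nd<16^t ⟩
    (4 ^ t * 4 ^ t) * 3 ^ (10 * t)    ≡⟨ cong₂ _*_ (sym (^-distribʳ-* 4 4 t)) (sym (^-*-assoc 3 10 t)) ⟩
    16 ^ t * (3 ^ 10) ^ t             ≡⟨ sym (^-distribʳ-* 16 (3 ^ 10) t) ⟩
    (16 * 3 ^ 10) ^ t                 ≤⟨ ^-monoˡ-≤ t (≤ᵇ⇒≤ (16 * 3 ^ 10) (4 ^ 10) _) ⟩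
    (4 ^ 10) ^ t                      ≡⟨ ^-*-assoc 4 10 t ⟩
    4 ^ (10 * t) ∎
    where
    open ≤-Reasoning
    s = suc t
    2nd<16^t : 2 * n * d < 4 ^ t * 4 ^ t
    2nd<16^t = begin-strict
      2 * n * d               <⟨ *-monoˡ-< d (*-monoʳ-< 2 n<200[1+t]²) ⟩
      2 * (200 * s * s) * d   ≡⟨ solve 2 (λ s d → con 2 :* (con 200 :* s :* s) :* d := (con 400 :* d) :* (s :* s)) refl s d ⟩
      (400 * d) * (s * s)     ≤⟨ *-monoˡ-≤ (s * s) (≤-trans 400d≤1+t (m≤m*n s s)) ⟩
      (s * s) * (s * s)       ≤⟨ *-mono-≤ ([1+t]²≤4^t t) ([1+t]²≤4^t t) ⟩
      4 ^ t * 4 ^ t ∎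

  ∣G/D-1∣< : ∀ G B D a d (ε : ℚ) .{{_ : NonZero D}} → toℚᵘ ε ≡ mkℚᵘ (ℤ.+ suc a) d → G + B ≡ D →
             B * suc d < suc a * D → ℚ.∣ ℤ.+ G / D ℚ.- 1ℚ ∣ ℚ.< ε
  ∣G/D-1∣< G B D@(suc D′) a d ε ε≡ G+B≡D B[1+d]<[1+a]D =
    ℚₚ.toℚᵘ-cancel-< (subst (toℚᵘ ℚ.∣ ℤ.+ G / D ℚ.- 1ℚ ∣ ℚᵘ.<_) (sym ε≡)
      (ℚᵘₚ.<-respˡ-≃ (ℚᵘₚ.≃-sym toℚᵘ-∣G/D-1∣) (*<* (subst₂ ℤ._<_ lhs rhs (ℤ.+<+ B[1+d]<[1+a]D)))))
    where
    G-D : ℤ.ℤ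
    G-D = ℤ.+ G ℤ.* ℤ.+ 1 ℤ.+ ℤ.- ℤ.+ 1 ℤ.* ℤ.+ D
    toℚᵘ-∣G/D-1∣ : toℚᵘ ℚ.∣ ℤ.+ G / D ℚ.- 1ℚ ∣ ℚᵘ.≃ ℚᵘ.∣ mkℚᵘ (ℤ.+ G) D′ ℚᵘ.- ℚᵘ.1ℚᵘ ∣
    toℚᵘ-∣G/D-1∣ = ℚᵘₚ.≃-trans (ℚₚ.toℚᵘ-homo-∣-∣ (ℤ.+ G / D ℚ.- 1ℚ)) (ℚᵘₚ.∣-∣-cong
      (ℚᵘₚ.≃-trans (ℚₚ.toℚᵘ-homo-+ (ℤ.+ G / D) (ℚ.- 1ℚ))
        (ℚᵘₚ.+-cong (ℚₚ.toℚᵘ-fromℚᵘ (mkℚᵘ (ℤ.+ G) D′)) (ℚₚ.toℚᵘ-homo‿- 1ℚ))))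
    ∣G-D∣≡B : ℤ.∣ G-D ∣ ≡ B
    ∣G-D∣≡B = begin
      ℤ.∣ G-D ∣                   ≡⟨ cong ℤ.∣_∣ (cong₂ ℤ._+_ (ℤₚ.*-identityʳ (ℤ.+ G)) (ℤₚ.-1*i≡-i (ℤ.+ D))) ⟩
      ℤ.∣ G ⊖ D ∣                 ≡⟨ cong ℤ.∣_∣ (ℤₚ.⊖-≤ (subst (G ≤_) G+B≡D (m≤m+n G B))) ⟩
      ℤ.∣ ℤ.- ℤ.+ (D ∸ G) ∣       ≡⟨ ℤₚ.∣-i∣≡∣i∣ (ℤ.+ (D ∸ G)) ⟩
      D ∸ G                       ≡⟨ cong (_∸ G) (sym G+B≡D) ⟩
      G + B ∸ G                   ≡⟨ m+n∸m≡n G B ⟩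
      B ∎
      where open ≡-Reasoning
    lhs : ℤ.+ (B * suc d) ≡ ℤ.+ ℤ.∣ G-D ∣ ℤ.* ℤ.+ suc d
    lhs = trans (ℤₚ.pos-* B (suc d)) (cong (λ b → ℤ.+ b ℤ.* ℤ.+ suc d) (sym ∣G-D∣≡B))
    rhs : ℤ.+ (suc a * D) ≡ ℤ.+ suc a ℤ.* ℤ.+ (D * 1)
    rhs = trans (ℤₚ.pos-* (suc a) D) (cong (λ e → ℤ.+ suc a ℤ.* ℤ.+ e) (sym (*-identityʳ D)))

  module _ (n : ℕ) .{{_ : NonZero n}} where

    sizesAgree : Vec Bool (n + n) → Bool
    sizesAgree w = does (sumsetSize n (halves n w) ≟ diffsetSize n (halves n w))

    goodCount≡count : goodCount n ≡ count (n + n) sizesAgree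
    goodCount≡count = trans (length-filter≡sumList _ (allSubsetsD n)) (sumList-allSubsetsD n _)

    disagree⇒unlucky : ∀ {L} → 2 * L * L ≤ n → ∀ w → not (sizesAgree w) ≡ true → unlucky n L w ≡ true
    disagree⇒unlucky {L} 2LL≤n w disagree with unlucky n L w in unlucky≡
    ... | true  = refl
    ... | false = contradiction disagree agree
      where
      R = take n w
      F = drop n w
      sizes : sumsetSize n (R , F) ≡ diffsetSize n (R , F)
      sizes = sumsetSize≡diffsetSize n (R , F)
                (lucky⇒witnesses n {L} 2LL≤n R F (trans (cong (unlucky n L) (take++drop≡id n w)) unlucky≡))
      agree : not (sizesAgree w) ≢ true
      agree rewrite dec-true (sumsetSize n (R , F) ≟ diffsetSize n (R , F)) sizes = λ ()

    -- With t = ⌊√(n / 200)⌋, families of L = 10 t pairs fit into D_{2n}, and (3/4)^L < 1 / (2 n (d + 1))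
    -- once t ≥ 400 (d + 1).
    few-disagreeing : ∀ d → 200 * (400 * suc d) * (400 * suc d) ≤ n →
                      ∃ λ B → goodCount n + B ≡ 2 ^ (2 * n) × B * suc d < 2 ^ (2 * n)
    few-disagreeing d large = B , total , subst (B * suc d <_) (cong (2 ^_) (m+m≡2*m n)) B[1+d]<D
      where
      N = n + n
      D = 2 ^ N
      t = root 200 n
      L = 10 * t
      B = count N (λ w → not (sizesAgree w))
      total : goodCount n + B ≡ 2 ^ (2 * n)
      total = trans (cong (_+ B) goodCount≡count) (trans (count-complement N sizesAgree) (cong (2 ^_) (m+m≡2*m n)))
      2LL≤n : 2 * L * L ≤ n
      2LL≤n = ≤-trans (≤-reflexive (solve 1 (λ t → con 2 :* (con 10 :* t) :* (con 10 :* t) := con 200 :* t :* t) refl t))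
                      (root-sound 200 n)
      4^L*B≤ : 4 ^ L * B ≤ n * (2 * (3 ^ L * D))
      4^L*B≤ = ≤-trans (*-monoʳ-≤ (4 ^ L) (count-mono N (disagree⇒unlucky {L} 2LL≤n))) (count-unlucky n {L} 2LL≤n)
      2nd3^L<4^L : 2 * n * suc d * 3 ^ L < 4 ^ L
      2nd3^L<4^L = 2nd3^[10t]<4^[10t] n (suc d) t (root-upper 200 n) (m≤n⇒m≤1+n (root-maximal 200 large))
      B[1+d]<D : B * suc d < D
      B[1+d]<D = *-cancelˡ-< (4 ^ L) (B * suc d) D (begin-strict
        4 ^ L * (B * suc d)            ≡⟨ sym (*-assoc (4 ^ L) B (suc d)) ⟩
        4 ^ L * B * suc d              ≤⟨ *-monoˡ-≤ (suc d) 4^L*B≤ ⟩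
        n * (2 * (3 ^ L * D)) * suc d
          ≡⟨ solve 4 (λ n e x y → n :* (con 2 :* (x :* y)) :* e := con 2 :* n :* e :* x :* y) refl n (suc d) (3 ^ L) D ⟩
        2 * n * suc d * 3 ^ L * D      <⟨ *-monoˡ-< D {{m^n≢0 2 N}} 2nd3^L<4^L ⟩
        4 ^ L * D ∎)
        where open ≤-Reasoning

open import Defs using (prob; goodCount)
open import Data.Integer using (+<+; +[1+_]; +0; -[1+_])
open import Data.Nat using (ℕ; NonZero; _≤_; suc; _*_; _^_)
open import Data.Nat.Properties using (<-≤-trans; m≤n*m; m^n≢0)
open import Data.Product using (∃; _,_)
open import Data.Rational using (ℚ; 0ℚ; 1ℚ; _<_; _-_; ∣_∣; mkℚ; *<*)
open import Relation.Binary.PropositionalEquality using (refl)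

theorem2 : (ε : ℚ) → 0ℚ < ε →
    ∃ λ (N : ℕ) → (n : ℕ) → .{{_ : NonZero n}} → N ≤ n →
      ∣ prob n - 1ℚ ∣ < ε
theorem2 ε@(mkℚ +[1+ a ] d _) _ = 200 * (400 * suc d) * (400 * suc d) , close
  where
  close : (n : ℕ) .{{_ : NonZero n}} → 200 * (400 * suc d) * (400 * suc d) ≤ n → ∣ prob n - 1ℚ ∣ < ε
  close n large = let B , good+B≡D , B[1+d]<D = few-disagreeing n d large in
    ∣G/D-1∣< (goodCount n) B (2 ^ (2 * n)) a d ε {{m^n≢0 2 (2 * n)}} refl good+B≡D
      (<-≤-trans B[1+d]<D (m≤n*m _ (suc a)))
theorem2 (mkℚ +0       _ _) (*<* (+<+ ()))
theorem2 (mkℚ -[1+ _ ] _ _) (*<* ())
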